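{- A sentential logic $\langle\mathcal{L},\mathcal{C},\vdash\rangle$ is substitution-invariant if and only if it has a strong semantics.
   Context: A sentential logic is a triple $\langle\mathcal{L},\mathcal{C},\vdash\rangle$ where $\mathcal{L}$ is the set of formulae freely generated from a set $\mathcal{A}$ of atoms by a (possibly empty) set $\mathcal{C}$ of connectives ($n$-ary connectives are maps $\mathcal{L}^n\to\mathcal{L}$), and $\vdash\subseteq\mathcal{P}(\mathcal{L})\times\mathcal{P}(\mathcal{L})$ is the consequence relation. A substitution is an endomorphism $\sigma$ of $\mathcal{L}$ (a map commuting with all connectives, hence determined by its values on atoms); $\Gamma[\sigma]=\{\sigma(F):F\in\Gamma\}$. The logic is substitution-invariant if $\Gamma\vdash\Delta$ implies $\Gamma[\sigma]\vdash\Delta[\sigma]$ for every substitution $\sigma$. A semantics is a triple $\langle\mathcal{V},\mathcal{W},[\![\cdot]\!]\rangle$: $\mathcal{V}$ a set of truth values, $\mathcal{W}$ a set of worlds, and $[\![\cdot]\!]$ assigns to each formula $F$ a proposition $[\![F]\!]:\mathcal{W}\to\mathcal{V}$, to each $n$-ary connective $c$ a function $[\![c]\!]$ from $n$-tuples of propositions to propositions, and to $\vdash$ a relation $\models$ between sets of propositions. It is compositional if $[\![c(F_1,\dots,F_n)]\!]=[\![c]\!]([\![F_1]\!],\dots,[\![F_n]\!])$ for all connectives and formulae; sound and complete if for all $\Gamma,\Delta$: $\Gamma\vdash\Delta$ iff $[\![\Gamma]\!]\models[\![\Delta]\!]$, with $[\![\Gamma]\!]=\{[\![F]\!]:F\in\Gamma\}$;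 adequate if both. It is truth-functional if for each $n$-ary connective $c$ there is $f_c:\mathcal{V}^n\to\mathcal{V}$ with $[\![c]\!](P_1,\dots,P_n)(w)=f_c(P_1(w),\dots,P_n(w))$ for all propositions $P_i$ and worlds $w$; truth-relational if there is $\Vdash\subseteq\mathcal{P}(\mathcal{V})\times\mathcal{P}(\mathcal{V})$ such that for all sets of propositions $S,P$: $S\models P$ iff for all $w$, $S(w)\Vdash P(w)$, where $S(w)=\{Q(w):Q\in S\}$; truth-adequate if adequate, truth-functional and truth-relational. A semantics is valuational if $\mathcal{W}$ is the set of all functions $\mathcal{A}\to\mathcal{V}$ and $[\![p]\!](v)=v(p)$ for all atoms $p$ and $v\in\mathcal{W}$. A semantics is strong if it is truth-adequate and valuational. -}

module Defs where

open import Data.Nat using (ℕ)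
open import Data.Vec using (Vec; map)
open import Data.Product using (Σ; _×_; _,_; ∃)
open import Function.Bundles using (_⇔_)
open import Relation.Binary.PropositionalEquality using (_≡_)

PSet : Set → Set₁
PSet X = X → Set

_≐_ : {X : Set} → PSet X → PSet X → Set
_≐_ {X} A B = ((x : X) → A x → B x) × ((x : X) → B x → A x)

image : {X Y : Set} → (X → Y) → PSet X → PSet Y
image {X} f A y = Σ X λ x → A x × f x ≡ y

record Signature : Set₁ where
  field
    Atom  : Set
    Conn  : Set
    arity : Conn → ℕ

module _ (Sig : Signature) where
  open Signature Sig

  data Formula : Set where
    atom : Atom → Formula
    app  : (c : Conn) → Vec Formula (arity c) → Formula

  -- A sentential logic over the signature: a consequence relation on
  -- subsets of formulae (as a relation on P(L) it respects set equality).
  record SententialLogic : Set₁ where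
    field
      _⊢_   : PSet Formula → PSet Formula → Set
      ⊢-resp : {Γ Γ' Δ Δ' : PSet Formula} → Γ ≐ Γ' → Δ ≐ Δ' → Γ ⊢ Δ → Γ' ⊢ Δ'

  record Substitution : Set where
    field
      apply : Formula → Formula
      hom   : (c : Conn) (Fs : Vec Formula (arity c)) →
              apply (app c Fs) ≡ app c (map apply Fs)

  SubstitutionInvariant : SententialLogic → Set₁
  SubstitutionInvariant L =
    (Γ Δ : PSet Formula) (σ : Substitution) →
    Γ ⊢ Δ → image (Substitution.apply σ) Γ ⊢ image (Substitution.apply σ) Δ
    where open SententialLogic L

  Prop : Set → Set → Set
  Prop V W = W → V

  _≗ₚ_ : {V W : Set} → Prop V W → Prop V W → Set
  _≗ₚ_ {V} {W} P Q = (w : W) → P w ≡ Q w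

  _≈ₛ_ : {V W : Set} → PSet (Prop V W) → PSet (Prop V W) → Set
  _≈ₛ_ {V} {W} S T =
    ((P : Prop V W) → S P → Σ (Prop V W) λ Q → T Q × P ≗ₚ Q) ×
    ((Q : Prop V W) → T Q → Σ (Prop V W) λ P → S P × P ≗ₚ Q)

  record Semantics (V W : Set) : Set₁ where
    field
      ⟦_⟧    : Formula → Prop V W
      ⟦_⟧ᶜ   : (c : Conn) → Vec (Prop V W) (arity c) → Prop V W
      _⊨_    : PSet (Prop V W) → PSet (Prop V W) → Set
      ⊨-resp : {S S' P P' : PSet (Prop V W)} →
               S ≈ₛ S' → P ≈ₛ P' → S ⊨ P → S' ⊨ P'

    ⟦_⟧ˢ : PSet Formula → PSet (Prop V W)
    ⟦ Γ ⟧ˢ = image ⟦_⟧ Γ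

  module _ {V W : Set} (Sem : Semantics V W) where
    open Semantics Sem

    Compositional : Set
    Compositional = (c : Conn) (Fs : Vec Formula (arity c)) →
      ⟦ app c Fs ⟧ ≗ₚ ⟦ c ⟧ᶜ (map ⟦_⟧ Fs)

    SoundAndComplete : SententialLogic → Set₁
    SoundAndComplete L = (Γ Δ : PSet Formula) → (Γ ⊢ Δ) ⇔ (⟦ Γ ⟧ˢ ⊨ ⟦ Δ ⟧ˢ)
      where open SententialLogic L

    Adequate : SententialLogic → Set₁
    Adequate L = Compositional × SoundAndComplete L

    TruthFunctional : Set
    TruthFunctional = (c : Conn) → Σ (Vec V (arity c) → V) λ f →
      (Ps : Vec (Prop V W) (arity c)) (w : W) →
      ⟦ c ⟧ᶜ Ps w ≡ f (map (λ P → P w) Ps)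

    at : PSet (Prop V W) → W → PSet V
    at S w = image (λ Q → Q w) S

    TruthRelational : Set₁
    TruthRelational = Σ (PSet V → PSet V → Set) λ _⊩_ →
      ({A A' B B' : PSet V} → A ≐ A' → B ≐ B' → A ⊩ B → A' ⊩ B') ×
      ((S P : PSet (Prop V W)) → (S ⊨ P) ⇔ ((w : W) → at S w ⊩ at P w))

    TruthAdequate : SententialLogic → Set₁
    TruthAdequate L = Adequate L × TruthFunctional × TruthRelational

  Valuational : {V : Set} → Semantics V (Atom → V) → Set
  Valuational {V} Sem = (p : Atom) (v : Atom → V) → ⟦ atom p ⟧ v ≡ v p
    where open Semantics Sem

  Strong : {V : Set} → SententialLogic → Semantics V (Atom → V) → Set₁
  Strong L Sem = TruthAdequate Sem L × Valuational Sem

  HasStrongSemantics : SententialLogic → Set₁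
  HasStrongSemantics L =
    Σ Set λ V → Σ (Semantics V (Atom → V)) λ Sem → Strong L Sem

-- A substitution-invariant logic is captured by its term model: formulae are
-- the truth values, valuations p ↦ σ(p) into formulae are the worlds,
-- ⟦F⟧(σ) = σ(F), and S ⊨ P iff S(σ) ⊢ P(σ) for every σ. Soundness is
-- substitution-invariance; completeness is the instance σ = identity.
-- Conversely, in a compositional, truth-functional, valuational semantics the
-- value of σ(F) at v is the value of F at the valuation p ↦ ⟦σ(p)⟧(v), so
-- truth-relationality transports Γ ⊢ Δ along σ.
module Submission where

open import Data.Product using (_,_; proj₁; proj₂)
open import Data.Vec using (Vec; []; _∷_; map)
open import Data.Vec.Properties using (map-∘)
open import Function using (_∘_; id)
open import Function.Bundles using (_⇔_; mk⇔; module Equivalence)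
open import Relation.Binary.PropositionalEquality

open import Defs

≐-sym : {X : Set} {A B : PSet X} → A ≐ B → B ≐ A
≐-sym (A⊆B , B⊆A) = B⊆A , A⊆B

≐-trans : {X : Set} {A B C : PSet X} → A ≐ B → B ≐ C → A ≐ C
≐-trans (A⊆B , B⊆A) (B⊆C , C⊆B) =
  (λ x → B⊆C x ∘ A⊆B x) , (λ x → B⊆A x ∘ C⊆B x)

image-∘ : {X Y Z : Set} (g : Y → Z) (f : X → Y) (A : PSet X) →
          image g (image f A) ≐ image (g ∘ f) A
image-∘ g f A =
  (λ { _ (_ , (x , x∈A , refl) , refl) → x , x∈A , refl }) ,
  (λ { _ (x , x∈A , refl) → f x , (x , x∈A , refl) , refl })

image-cong : {X Y : Set} {f g : X → Y} → (∀ x → f x ≡ g x) →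
             (A : PSet X) → image f A ≐ image g A
image-cong f≗g A =
  (λ { _ (x , x∈A , refl) → x , x∈A , sym (f≗g x) }) ,
  (λ { _ (x , x∈A , refl) → x , x∈A , f≗g x })

image-id : {X : Set} {f : X → X} → (∀ x → f x ≡ x) →
           (A : PSet X) → image f A ≐ A
image-id f≗id A =
  (λ { _ (x , x∈A , refl) → subst A (sym (f≗id x)) x∈A }) ,
  (λ x x∈A → x , x∈A , f≗id x)

module _ (Sig : Signature) where
  open Signature Sig

  ≈ₛ⇒at≐ : {V W : Set} {S S' : PSet (Prop Sig V W)} → _≈ₛ_ Sig S S' →
           (w : W) → image (λ Q → Q w) S ≐ image (λ Q → Q w) S'
  ≈ₛ⇒at≐ (S⊆S' , S'⊆S) w =
    (λ { _ (Q , Q∈S , refl) → let (Q' , Q'∈S' , Q≗Q') = S⊆S' Q Q∈S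
                               in Q' , Q'∈S' , sym (Q≗Q' w) }) ,
    (λ { _ (Q' , Q'∈S' , refl) → let (Q , Q∈S , Q≗Q') = S'⊆S Q' Q'∈S'
                                  in Q , Q∈S , Q≗Q' w })

  mutual
    substitute : (Atom → Formula Sig) → Formula Sig → Formula Sig
    substitute v (atom p)   = v p
    substitute v (app c Fs) = app c (substituteAll v Fs)

    substituteAll : ∀ {n} → (Atom → Formula Sig) →
                    Vec (Formula Sig) n → Vec (Formula Sig) n
    substituteAll v []       = []
    substituteAll v (F ∷ Fs) = substitute v F ∷ substituteAll v Fs

  substituteAll≡map : ∀ {n} (v : Atom → Formula Sig) (Fs : Vec (Formula Sig) n) →
                      substituteAll v Fs ≡ map (substitute v) Fs
  substituteAll≡map v []       = refl
  substituteAll≡map v (F ∷ Fs) = cong (substitute v F ∷_) (substituteAll≡map v Fs)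

  mutual
    substitute-atom : (F : Formula Sig) → substitute atom F ≡ F
    substitute-atom (atom p)   = refl
    substitute-atom (app c Fs) = cong (app c) (substituteAll-atom Fs)

    substituteAll-atom : ∀ {n} (Fs : Vec (Formula Sig) n) → substituteAll atom Fs ≡ Fs
    substituteAll-atom []       = refl
    substituteAll-atom (F ∷ Fs) = cong₂ _∷_ (substitute-atom F) (substituteAll-atom Fs)

  substitution : (Atom → Formula Sig) → Substitution Sig
  substitution v = record
    { apply = substitute v
    ; hom   = λ c Fs → cong (app c) (substituteAll≡map v Fs)
    }

  module TermModel (L : SententialLogic Sig) where
    open SententialLogic L

    termSemantics : Semantics Sig (Formula Sig) (Atom → Formula Sig)
    termSemantics = record
      { ⟦_⟧    = λ F v → substitute v F
      ; ⟦_⟧ᶜ   = λ c Ps v → app c (map (λ P → P v) Ps)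
      ; _⊨_    = λ S P → ∀ v → image (λ Q → Q v) S ⊢ image (λ Q → Q v) P
      ; ⊨-resp = λ S≈S' P≈P' S⊨P v →
                   ⊢-resp (≈ₛ⇒at≐ S≈S' v) (≈ₛ⇒at≐ P≈P' v) (S⊨P v)
      }

    open Semantics termSemantics

    at-⟦⟧ˢ : (Γ : PSet (Formula Sig)) (v : Atom → Formula Sig) →
             at Sig termSemantics ⟦ Γ ⟧ˢ v ≐ image (substitute v) Γ
    at-⟦⟧ˢ Γ v = image-∘ (λ P → P v) ⟦_⟧ Γ

    compositional : Compositional Sig termSemantics
    compositional c Fs v =
      cong (app c) (trans (substituteAll≡map v Fs) (map-∘ (λ P → P v) ⟦_⟧ Fs))

    soundAndComplete : SubstitutionInvariant Sig L → SoundAndComplete Sig termSemantics L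
    soundAndComplete invariant Γ Δ = mk⇔ sound complete
      where
        sound : Γ ⊢ Δ → ⟦ Γ ⟧ˢ ⊨ ⟦ Δ ⟧ˢ
        sound Γ⊢Δ v = ⊢-resp (≐-sym (at-⟦⟧ˢ Γ v)) (≐-sym (at-⟦⟧ˢ Δ v))
                             (invariant Γ Δ (substitution v) Γ⊢Δ)

        at-atom : (Θ : PSet (Formula Sig)) → at Sig termSemantics ⟦ Θ ⟧ˢ atom ≐ Θ
        at-atom Θ = ≐-trans (at-⟦⟧ˢ Θ atom) (image-id substitute-atom Θ)

        complete : ⟦ Γ ⟧ˢ ⊨ ⟦ Δ ⟧ˢ → Γ ⊢ Δ
        complete ⟦Γ⟧⊨⟦Δ⟧ = ⊢-resp (at-atom Γ) (at-atom Δ) (⟦Γ⟧⊨⟦Δ⟧ atom)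

    strong : SubstitutionInvariant Sig L → Strong Sig L termSemantics
    strong invariant =
      ( (compositional , soundAndComplete invariant)
      , (λ c → app c , λ Ps v → refl)
      , (_⊢_ , ⊢-resp , λ S P → mk⇔ id id) )
      , λ p v → refl

  module _ {V : Set} (Sem : Semantics Sig V (Atom → V)) where
    open Semantics Sem

    module Pullback (compositional : Compositional Sig Sem)
             (truthFunctional : TruthFunctional Sig Sem)
             (valuational : Valuational Sig Sem)
             (σ : Substitution Sig) (v : Atom → V) where
      open Substitution σ

      pullback : Atom → V
      pullback p = ⟦ apply (atom p) ⟧ v

      mutual
        substitution-lemma : (F : Formula Sig) → ⟦ apply F ⟧ v ≡ ⟦ F ⟧ pullback
        substitution-lemma (atom p)   = sym (valuational p pullback)
        substitution-lemma (app c Fs) = begin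
          ⟦ apply (app c Fs) ⟧ v                      ≡⟨ cong (λ G → ⟦ G ⟧ v) (hom c Fs) ⟩
          ⟦ app c (map apply Fs) ⟧ v                  ≡⟨ compositional c (map apply Fs) v ⟩
          ⟦ c ⟧ᶜ (map ⟦_⟧ (map apply Fs)) v           ≡⟨ f-spec _ v ⟩
          f (map (λ P → P v) (map ⟦_⟧ (map apply Fs))) ≡⟨ cong f (substitution-lemmaAll Fs) ⟩
          f (map (λ P → P pullback) (map ⟦_⟧ Fs))      ≡⟨ f-spec _ pullback ⟨
          ⟦ c ⟧ᶜ (map ⟦_⟧ Fs) pullback                ≡⟨ compositional c Fs pullback ⟨
          ⟦ app c Fs ⟧ pullback                       ∎
          where
            open ≡-Reasoning
            f = proj₁ (truthFunctional c)
            f-spec = proj₂ (truthFunctional c)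

        substitution-lemmaAll : ∀ {n} (Fs : Vec (Formula Sig) n) →
          map (λ P → P v) (map ⟦_⟧ (map apply Fs)) ≡ map (λ P → P pullback) (map ⟦_⟧ Fs)
        substitution-lemmaAll []       = refl
        substitution-lemmaAll (F ∷ Fs) =
          cong₂ _∷_ (substitution-lemma F) (substitution-lemmaAll Fs)

      at-⟦image⟧ˢ : (Γ : PSet (Formula Sig)) →
                    at Sig Sem ⟦ image apply Γ ⟧ˢ v ≐ at Sig Sem ⟦ Γ ⟧ˢ pullback
      at-⟦image⟧ˢ Γ =
        ≐-trans (image-∘ (λ P → P v) ⟦_⟧ (image apply Γ))
        (≐-trans (image-∘ (λ F → ⟦ F ⟧ v) apply Γ)
        (≐-trans (image-cong substitution-lemma Γ)
                 (≐-sym (image-∘ (λ P → P pullback) ⟦_⟧ Γ))))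

    substitutionInvariant : (L : SententialLogic Sig) → Strong Sig L Sem →
                            SubstitutionInvariant Sig L
    substitutionInvariant L (((compositional , soundComplete) , truthFunctional ,
                              (_⊩_ , ⊩-resp , truthRelational)) , valuational)
                          Γ Δ σ Γ⊢Δ =
      from (soundComplete _ _) (from (truthRelational _ _) λ v →
        ⊩-resp (≐-sym (at-⟦image⟧ˢ σ v Γ)) (≐-sym (at-⟦image⟧ˢ σ v Δ))
               (to (truthRelational _ _) (to (soundComplete Γ Δ) Γ⊢Δ) (pullback σ v)))
      where
        open Equivalence
        open Pullback compositional truthFunctional valuational

theorem3p1 : (Sig : Signature) (L : SententialLogic Sig) →
    SubstitutionInvariant Sig L ⇔ HasStrongSemantics Sig L
theorem3p1 Sig L = mk⇔
  (λ invariant → _ , termSemantics , strong invariant)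
  (λ { (_ , Sem , isStrong) → substitutionInvariant Sig Sem L isStrong })
  where open TermModel Sig L
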